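{- Let $T$ be a tree of order $n\geq 2$. Then (i) $T$ has at least $n/2+1$ vertices of degree at most $2$; and (ii) $T$ contains an independent set $I$ with $|I|\geq n/4$ such that every vertex of $I$ has degree at most $2$ in $T$. -}

module Defs where

open import Data.Nat using (ℕ; _≤_; _≤?_; _<_)
open import Data.Bool using (Bool; true; false)
open import Data.Fin using (Fin)
open import Data.Fin.Subset using (Subset; _∈_; ∣_∣)
open import Data.Vec using (tabulate)
open import Data.List using (List; []; _∷_; _++_; [_]; length)
open import Data.List.Relation.Unary.Linked using (Linked)
open import Data.List.Relation.Unary.Unique.Propositional using (Unique)
open import Data.Product using (Σ; ∃; _×_)
open import Relation.Nullary using (¬_)
open import Relation.Nullary.Decidable using (⌊_⌋)
open import Relation.Binary.PropositionalEquality using (_≡_)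

record Graph (n : ℕ) : Set where
  field
    adj    : Fin n → Fin n → Bool
    sym    : ∀ i j → adj i j ≡ adj j i
    irrefl : ∀ i → adj i i ≡ false

module _ {n : ℕ} (G : Graph n) where
  open Graph G

  Adj : Fin n → Fin n → Set
  Adj i j = adj i j ≡ true

  data Walk : Fin n → Fin n → Set where
    [] : ∀ {u} → Walk u u
    _∷_ : ∀ {u w v} → Adj u w → Walk w v → Walk u v

  Connected : Set
  Connected = ∀ u v → Walk u v

  -- a cycle: distinct vertices x, y₁, …, yₖ, z (k ≥ 1, so at least 3 vertices)
  -- with consecutive ones adjacent and z adjacent to x
  HasCycle : Set
  HasCycle = Σ (Fin n) λ x → Σ (List (Fin n)) λ ys → Σ (Fin n) λ z →
    1 ≤ length ys × Unique (x ∷ ys ++ [ z ]) × Linked Adj (x ∷ ys ++ [ z ]) × Adj z x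

  Acyclic : Set
  Acyclic = ¬ HasCycle

  IsTree : Set
  IsTree = Connected × Acyclic

  degree : Fin n → ℕ
  degree i = ∣ tabulate (adj i) ∣

  lowDegCount : ℕ
  lowDegCount = ∣ tabulate (λ i → ⌊ degree i ≤? 2 ⌋) ∣

  Independent : Subset n → Set
  Independent I = ∀ i j → i ∈ I → j ∈ I → ¬ Adj i j

-- A finite forest always has a vertex of degree at most one: otherwise a
-- non-backtracking walk could be continued forever, and its first repeated
-- vertex would close a cycle. Deleting such vertices one at a time shows that a
-- forest on n + 1 vertices has degree sum at most 2n and is properly
-- 2-colourable. In a tree every vertex has degree at least one, so summing
-- degree v + 2·[degree v ≤ 2] ≥ 3 over all vertices and comparing with the
-- degree sum gives (i); the larger of the two colour classes among the vertices
-- of degree at most 2 is the independent set of (ii).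
module Submission where

open import Defs
open import Algebra.Properties.Semiring.Sum as Sum using ()
open import Data.Bool as Bool using (Bool; true; false; not; _∧_; T)
open import Data.Bool.Properties using (T-≡; T-∧; not-injective; not-¬)
open import Data.Empty using (⊥-elim)
open import Data.Fin using (Fin; zero; suc; punchIn; punchOut; toℕ)
open import Data.Fin.Properties as Fin using (punchIn-punchOut; punchInᵢ≢i; punchIn-injective; pigeonhole; toℕ≤pred[n])
open import Data.Fin.Subset using (Subset; _∈_; ∣_∣)
open import Data.List using (_∷_; _++_; [_]; map; applyUpTo)
open import Data.List.Properties using (map-++; length-map; applyUpTo-∷ʳ)
open import Data.List.Relation.Unary.Linked as Linked using (Linked)
import Data.List.Relation.Unary.Linked.Properties as Linked
open import Data.List.Relation.Unary.Unique.Propositional using (Unique)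
import Data.List.Relation.Unary.Unique.Propositional.Properties as Unique
open import Data.Nat using (ℕ; zero; suc; _≤_; _<_; _+_; _*_; _∸_; z≤n; s≤s; s≤s⁻¹; _≤?_)
open import Data.Nat.Properties
open import Data.Nat.Tactic.RingSolver using (solve-∀)
open import Data.Product using (Σ; ∃; _×_; _,_; proj₁; proj₂)
open import Data.Sum using (_⊎_; inj₁; inj₂)
open import Data.Vec using (tabulate)
open import Data.Vec.Functional using (removeAt; insertAt)
open import Data.Vec.Functional.Properties using (insertAt-lookup; insertAt-punchIn)
open import Data.Vec.Properties using (lookup∘tabulate; []=⇒lookup)
open import Function using (_∘_; Equivalence; case_of_)
open import Relation.Binary.PropositionalEquality using (_≡_; _≢_; refl; sym; trans; cong; cong₂; subst; module ≡-Reasoning)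
open import Relation.Nullary using (¬_; yes; no; contradiction)
open import Relation.Nullary.Decidable using (⌊_⌋; toWitness)

open Sum +-*-semiring using (sum; sum-cong-≗; sum-remove; ∑-distrib-+; *-distribˡ-sum)
open Equivalence using (to; from)

indicator : Bool → ℕ
indicator true  = 1
indicator false = 0

indicator≤1 : ∀ b → indicator b ≤ 1
indicator≤1 true  = ≤-refl
indicator≤1 false = z≤n

∣tabulate∣≡sum : ∀ {n} (f : Fin n → Bool) → ∣ tabulate f ∣ ≡ sum (indicator ∘ f)
∣tabulate∣≡sum {zero}  f = refl
∣tabulate∣≡sum {suc n} f with f zero
... | true  = cong suc (∣tabulate∣≡sum (f ∘ suc))
... | false = ∣tabulate∣≡sum (f ∘ suc)

∣tabulate∣-removeAt : ∀ {n} (f : Fin (suc n) → Bool) i →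
  ∣ tabulate f ∣ ≡ indicator (f i) + ∣ tabulate (removeAt f i) ∣
∣tabulate∣-removeAt f i = begin
  ∣ tabulate f ∣                                   ≡⟨ ∣tabulate∣≡sum f ⟩
  sum (indicator ∘ f)                              ≡⟨ sum-remove {i = i} (indicator ∘ f) ⟩
  indicator (f i) + sum (indicator ∘ removeAt f i) ≡⟨ cong (indicator (f i) +_) (∣tabulate∣≡sum (removeAt f i)) ⟨
  indicator (f i) + ∣ tabulate (removeAt f i) ∣    ∎
  where open ≡-Reasoning

∈-tabulate⁻ : ∀ {n} {f : Fin n → Bool} {i} → i ∈ tabulate f → T (f i)
∈-tabulate⁻ {f = f} {i} i∈f = T-≡ .from (trans (sym (lookup∘tabulate f i)) ([]=⇒lookup i∈f))

true⇒1≤∣tabulate∣ : ∀ {n} (f : Fin n → Bool) {i} → f i ≡ true → 1 ≤ ∣ tabulate f ∣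
true⇒1≤∣tabulate∣ {suc n} f {i} fi rewrite ∣tabulate∣-removeAt f i | fi = s≤s z≤n

1≤∣tabulate∣⇒true : ∀ {n} (f : Fin n → Bool) → 1 ≤ ∣ tabulate f ∣ → ∃ λ i → f i ≡ true
1≤∣tabulate∣⇒true {suc n} f 1≤∣f∣ with f zero in f0
... | true  = zero , f0
... | false with 1≤∣tabulate∣⇒true (f ∘ suc) 1≤∣f∣
...   | i , fi = suc i , fi

∣tabulate∣≤1⇒unique : ∀ {n} (f : Fin n → Bool) {i j} →
  ∣ tabulate f ∣ ≤ 1 → f i ≡ true → f j ≡ true → i ≡ j
∣tabulate∣≤1⇒unique {suc n} f {i} {j} ∣f∣≤1 fi fj with i Fin.≟ j
... | yes i≡j = i≡j
... | no  i≢j = contradiction ∣f∣≤1 (<⇒≱ 2≤∣f∣)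
  where
  2≤∣f∣ : 2 ≤ ∣ tabulate f ∣
  2≤∣f∣ rewrite ∣tabulate∣-removeAt f i | fi =
    s≤s (true⇒1≤∣tabulate∣ (removeAt f i) (trans (cong f (punchIn-punchOut i≢j)) fj))

2≤∣tabulate∣⇒1≤∣tabulate-removeAt∣ : ∀ {n} (f : Fin (suc n) → Bool) i →
  2 ≤ ∣ tabulate f ∣ → 1 ≤ ∣ tabulate (removeAt f i) ∣
2≤∣tabulate∣⇒1≤∣tabulate-removeAt∣ f i 2≤∣f∣ = +-cancelˡ-≤ 1 1 _ (begin
  2                                             ≤⟨ 2≤∣f∣ ⟩
  ∣ tabulate f ∣                                ≡⟨ ∣tabulate∣-removeAt f i ⟩
  indicator (f i) + ∣ tabulate (removeAt f i) ∣ ≤⟨ +-monoˡ-≤ _ (indicator≤1 (f i)) ⟩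
  1 + ∣ tabulate (removeAt f i) ∣               ∎)
  where open ≤-Reasoning

2≤∣tabulate∣⇒other : ∀ {n} (f : Fin n → Bool) → 2 ≤ ∣ tabulate f ∣ →
  ∀ p → ∃ λ i → f i ≡ true × i ≢ p
2≤∣tabulate∣⇒other {suc n} f 2≤∣f∣ p
  with 1≤∣tabulate∣⇒true (removeAt f p) (2≤∣tabulate∣⇒1≤∣tabulate-removeAt∣ f p 2≤∣f∣)
... | j , fj = punchIn p j , fj , punchInᵢ≢i p j

∣tabulate∣≤1⇒avoidable : ∀ {n} (f c : Fin n → Bool) → ∣ tabulate f ∣ ≤ 1 →
  ∃ λ b → ∀ j → f j ≡ true → b ≢ c j
∣tabulate∣≤1⇒avoidable f c ∣f∣≤1 with Fin.any? (λ j → f j Bool.≟ true)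
... | yes (i , fi) = not (c i) , λ j fj → subst (λ k → not (c i) ≢ c k)
                       (∣tabulate∣≤1⇒unique f ∣f∣≤1 fi fj) (not-¬ refl ∘ sym)
... | no none      = true , λ j fj → contradiction (j , fj) none

∣∧∣+∣∧not∣≡∣tabulate∣ : ∀ {n} (f c : Fin n → Bool) →
  ∣ tabulate (λ i → f i ∧ c i) ∣ + ∣ tabulate (λ i → f i ∧ not (c i)) ∣ ≡ ∣ tabulate f ∣
∣∧∣+∣∧not∣≡∣tabulate∣ f c = begin
  ∣ tabulate (λ i → f i ∧ c i) ∣ + ∣ tabulate (λ i → f i ∧ not (c i)) ∣
    ≡⟨ cong₂ _+_ (∣tabulate∣≡sum (λ i → f i ∧ c i)) (∣tabulate∣≡sum (λ i → f i ∧ not (c i))) ⟩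
  sum (λ i → indicator (f i ∧ c i)) + sum (λ i → indicator (f i ∧ not (c i)))
    ≡⟨ ∑-distrib-+ (λ i → indicator (f i ∧ c i)) (λ i → indicator (f i ∧ not (c i))) ⟨
  sum (λ i → indicator (f i ∧ c i) + indicator (f i ∧ not (c i)))
    ≡⟨ sum-cong-≗ (λ i → split (f i) (c i)) ⟩
  sum (indicator ∘ f)
    ≡⟨ ∣tabulate∣≡sum f ⟨
  ∣ tabulate f ∣ ∎
  where
  open ≡-Reasoning
  split : ∀ x y → indicator (x ∧ y) + indicator (x ∧ not y) ≡ indicator x
  split true  true  = refl
  split true  false = refl
  split false _     = refl

*≤sum : ∀ {n} c (f : Fin n → ℕ) → (∀ i → c ≤ f i) → n * c ≤ sum f
*≤sum {zero}  c f c≤f = z≤n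
*≤sum {suc n} c f c≤f = +-mono-≤ (c≤f zero) (*≤sum c (f ∘ suc) (c≤f ∘ suc))

+≤2*⊎+≤2* : ∀ a b → a + b ≤ 2 * a ⊎ a + b ≤ 2 * b
+≤2*⊎+≤2* a b with ≤-total b a
... | inj₁ b≤a = inj₁ (+-monoʳ-≤ a (≤-trans b≤a (≤-reflexive (sym (+-identityʳ a)))))
... | inj₂ a≤b = inj₂ (subst (a + b ≤_) (cong (b +_) (sym (+-identityʳ b))) (+-monoˡ-≤ b a≤b))

module _ {n : ℕ} (G : Graph n) where
  open Graph G using (adj; irrefl)

  ¬Adj-refl : ∀ {i} → ¬ Adj G i i
  ¬Adj-refl {i} a with trans (sym a) (irrefl i)
  ... | ()

  Adj-sym : ∀ {i j} → Adj G i j → Adj G j i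
  Adj-sym {i} {j} a = trans (Graph.sym G j i) a

  walk⇒neighbour : ∀ {u v} → Walk G u v → u ≢ v → ∃ (Adj G u)
  walk⇒neighbour []      u≢u = contradiction refl u≢u
  walk⇒neighbour (a ∷ _) _   = _ , a

  degreeSum : ℕ
  degreeSum = sum (degree G)

  lowDegree : Fin n → Bool
  lowDegree i = ⌊ degree G i ≤? 2 ⌋

  ProperColouring : (Fin n → Bool) → Set
  ProperColouring c = ∀ i j → Adj G i j → c i ≢ c j

  ProperColouring-not : ∀ {c} → ProperColouring c → ProperColouring (not ∘ c)
  ProperColouring-not proper i j a = proper i j a ∘ not-injective

  record NonBacktrackingWalk : Set where
    field
      vertex          : ℕ → Fin n
      step            : ∀ k → Adj G (vertex k) (vertex (suc k))
      nonBacktracking : ∀ k → vertex (suc (suc k)) ≢ vertex k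

  dropWalk : ℕ → NonBacktrackingWalk → NonBacktrackingWalk
  dropWalk i w = record
    { vertex          = λ k → vertex (k + i)
    ; step            = λ k → step (k + i)
    ; nonBacktracking = λ k → nonBacktracking (k + i)
    }
    where open NonBacktrackingWalk w

  minDegree≥2⇒walk : Fin n → (∀ v → 2 ≤ degree G v) → NonBacktrackingWalk
  minDegree≥2⇒walk v₀ 2≤degree = record
    { vertex          = λ k → proj₂ (arc k)
    ; step            = λ k → proj₁ (proj₂ (continue (arc k)))
    ; nonBacktracking = λ k → proj₂ (proj₂ (continue (arc (suc k))))
    }
    where
    continue : (pc : Fin n × Fin n) → ∃ λ w → Adj G (proj₂ pc) w × w ≢ proj₁ pc
    continue (p , c) = 2≤∣tabulate∣⇒other (adj c) (2≤degree c) p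

    -- arc k = (vertex (k ∸ 1) , vertex k); v₀ serves as its own dummy predecessor.
    arc : ℕ → Fin n × Fin n
    arc zero    = v₀ , v₀
    arc (suc k) = proj₂ (arc k) , proj₁ (continue (arc k))

  module _ (w : NonBacktrackingWalk) where
    open NonBacktrackingWalk w

    closedWalk⇒cycle : ∀ g → 1 ≤ g → vertex g ≡ vertex 0 →
      (∀ {p q} → p < q → q < g → vertex p ≢ vertex q) → HasCycle G
    closedWalk⇒cycle 1 _ closed _ = ⊥-elim (¬Adj-refl (subst (Adj G (vertex 0)) closed (step 0)))
    closedWalk⇒cycle 2 _ closed _ = ⊥-elim (nonBacktracking 0 closed)
    closedWalk⇒cycle (suc (suc (suc m))) _ closed distinct =
      vertex 0 , applyUpTo (vertex ∘ suc) (suc m) , vertex (2 + m) , s≤s z≤n ,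
      subst Unique cycle≡ (Unique.applyUpTo⁺₁ vertex (3 + m) distinct) ,
      subst (Linked (Adj G)) cycle≡ (Linked.applyUpTo⁺₂ vertex (3 + m) step) ,
      subst (Adj G (vertex (2 + m))) closed (step (2 + m))
      where
      cycle≡ : applyUpTo vertex (3 + m) ≡ vertex 0 ∷ applyUpTo (vertex ∘ suc) (suc m) ++ [ vertex (2 + m) ]
      cycle≡ = cong (vertex 0 ∷_) (sym (applyUpTo-∷ʳ (vertex ∘ suc) (suc m)))

  module _ (w : NonBacktrackingWalk) where
    open NonBacktrackingWalk w

    InjectiveUpTo : ℕ → Set
    InjectiveUpTo j = ∀ {p q} → p < q → q ≤ j → vertex p ≢ vertex q

    cycle⊎injectiveUpTo : ∀ j → HasCycle G ⊎ InjectiveUpTo j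
    cycle⊎injectiveUpTo zero = inj₂ λ p<q q≤0 → contradiction (<-≤-trans p<q q≤0) n≮0
    cycle⊎injectiveUpTo (suc j) with cycle⊎injectiveUpTo j
    ... | inj₁ cycle     = inj₁ cycle
    ... | inj₂ injective with anyUpTo? (λ p → vertex p Fin.≟ vertex (suc j)) (suc j)
    ...   | yes (i , i<1+j , repeated) =
      inj₁ (closedWalk⇒cycle (dropWalk i w) (suc j ∸ i) (m<n⇒0<n∸m i<1+j) closed distinct)
      where
      g+i≡1+j : suc j ∸ i + i ≡ suc j
      g+i≡1+j = m∸n+n≡m (<⇒≤ i<1+j)
      closed : vertex (suc j ∸ i + i) ≡ vertex i
      closed = trans (cong vertex g+i≡1+j) (sym repeated)
      distinct : ∀ {p q} → p < q → q < suc j ∸ i → vertex (p + i) ≢ vertex (q + i)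
      distinct {p} {q} p<q q<g = injective (+-monoˡ-< i p<q)
        (s≤s⁻¹ (subst (q + i <_) g+i≡1+j (+-monoˡ-< i q<g)))
    ...   | no notRepeated = inj₂ λ {p} {q} p<q q≤1+j → case m≤n⇒m<n∨m≡n q≤1+j of λ where
      (inj₁ q<1+j) → injective p<q (s≤s⁻¹ q<1+j)
      (inj₂ refl)  → λ repeated → notRepeated (p , p<q , repeated)

    walk⇒cycle : HasCycle G
    walk⇒cycle with cycle⊎injectiveUpTo n
    ... | inj₁ cycle     = cycle
    ... | inj₂ injective with pigeonhole (n<1+n n) (vertex ∘ toℕ)
    ...   | i , j , i<j , repeated = contradiction repeated (injective i<j (toℕ≤pred[n] j))

  acyclic⇒leaf : Acyclic G → Fin n → ∃ λ ℓ → degree G ℓ ≤ 1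
  acyclic⇒leaf acyclic v with Fin.any? (λ ℓ → degree G ℓ ≤? 1)
  ... | yes leaf  = leaf
  ... | no noLeaf = ⊥-elim (acyclic (walk⇒cycle (minDegree≥2⇒walk v λ u → ≰⇒> (noLeaf ∘ (u ,_)))))

cycle-map : ∀ {m n} {H : Graph m} {G : Graph n} (f : Fin m → Fin n) →
  (∀ {i j} → f i ≡ f j → i ≡ j) → (∀ {i j} → Adj H i j → Adj G (f i) (f j)) →
  HasCycle H → HasCycle G
cycle-map {G = G} f injective hom (x , ys , z , 1≤∣ys∣ , unique , linked , zx) =
  f x , map f ys , f z , subst (1 ≤_) (sym (length-map f ys)) 1≤∣ys∣ ,
  subst Unique map≡ (Unique.map⁺ injective unique) ,
  subst (Linked (Adj G)) map≡ (Linked.map⁺ (Linked.map hom linked)) ,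
  hom zx
  where
  map≡ : map f (x ∷ ys ++ [ z ]) ≡ f x ∷ map f ys ++ [ f z ]
  map≡ = cong (f x ∷_) (map-++ f ys [ z ])

module _ {n : ℕ} (ℓ : Fin (suc n)) where

  data PunchInView : Fin (suc n) → Set where
    pivot   : PunchInView ℓ
    punched : ∀ j → PunchInView (punchIn ℓ j)

  punchInView : ∀ i → PunchInView i
  punchInView i with ℓ Fin.≟ i
  ... | yes refl = pivot
  ... | no  ℓ≢i  = subst PunchInView (punchIn-punchOut ℓ≢i) (punched (punchOut ℓ≢i))

deleteVertex : ∀ {n} → Graph (suc n) → Fin (suc n) → Graph n
deleteVertex G ℓ = record
  { adj    = λ i j → Graph.adj G (punchIn ℓ i) (punchIn ℓ j)
  ; sym    = λ i j → Graph.sym G (punchIn ℓ i) (punchIn ℓ j)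
  ; irrefl = λ i → Graph.irrefl G (punchIn ℓ i)
  }

module _ {n : ℕ} (G : Graph (suc n)) (ℓ : Fin (suc n)) where
  open Graph G using (adj; irrefl)
  private
    G-ℓ = deleteVertex G ℓ

  acyclic-deleteVertex : Acyclic G → Acyclic G-ℓ
  acyclic-deleteVertex acyclic =
    acyclic ∘ cycle-map {H = G-ℓ} {G = G} (punchIn ℓ) (punchIn-injective ℓ _ _) (λ a → a)

  degree≡∣tabulate-removeAt∣ : degree G ℓ ≡ ∣ tabulate (removeAt (adj ℓ) ℓ) ∣
  degree≡∣tabulate-removeAt∣ = trans (∣tabulate∣-removeAt (adj ℓ) ℓ)
    (cong (λ b → indicator b + ∣ tabulate (removeAt (adj ℓ) ℓ) ∣) (irrefl ℓ))

  degreeSum-deleteVertex : degreeSum G ≡ degree G ℓ + (degree G ℓ + degreeSum G-ℓ)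
  degreeSum-deleteVertex = begin
    sum (degree G)
      ≡⟨ sum-remove {i = ℓ} (degree G) ⟩
    degree G ℓ + sum (degree G ∘ punchIn ℓ)
      ≡⟨ cong (degree G ℓ +_) (sum-cong-≗ degree-punchIn) ⟩
    degree G ℓ + sum (λ j → indicator (adj ℓ (punchIn ℓ j)) + degree G-ℓ j)
      ≡⟨ cong (degree G ℓ +_) (∑-distrib-+ (indicator ∘ removeAt (adj ℓ) ℓ) (degree G-ℓ)) ⟩
    degree G ℓ + (sum (indicator ∘ removeAt (adj ℓ) ℓ) + degreeSum G-ℓ)
      ≡⟨ cong (λ d → degree G ℓ + (d + degreeSum G-ℓ)) degree≡sum ⟨
    degree G ℓ + (degree G ℓ + degreeSum G-ℓ) ∎
    where
    open ≡-Reasoning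
    degree-punchIn : ∀ j → degree G (punchIn ℓ j) ≡ indicator (adj ℓ (punchIn ℓ j)) + degree G-ℓ j
    degree-punchIn j = trans (∣tabulate∣-removeAt (adj (punchIn ℓ j)) ℓ)
      (cong (λ b → indicator b + degree G-ℓ j) (Graph.sym G (punchIn ℓ j) ℓ))
    degree≡sum : degree G ℓ ≡ sum (indicator ∘ removeAt (adj ℓ) ℓ)
    degree≡sum = trans degree≡∣tabulate-removeAt∣ (∣tabulate∣≡sum (removeAt (adj ℓ) ℓ))

  insertAt-properColouring : ∀ {c b} → ProperColouring G-ℓ c →
    (∀ j → Adj G ℓ (punchIn ℓ j) → b ≢ c j) → ProperColouring G (insertAt c ℓ b)
  insertAt-properColouring {c} {b} proper avoids i j a with punchInView ℓ i | punchInView ℓ j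
  ... | pivot     | pivot     = ⊥-elim (¬Adj-refl G a)
  ... | pivot     | punched j
    rewrite insertAt-lookup c ℓ b | insertAt-punchIn c ℓ b j = avoids j a
  ... | punched i | pivot
    rewrite insertAt-lookup c ℓ b | insertAt-punchIn c ℓ b i = avoids i (Adj-sym G a) ∘ sym
  ... | punched i | punched j
    rewrite insertAt-punchIn c ℓ b i | insertAt-punchIn c ℓ b j = proper i j a

acyclic⇒degreeSum≤ : ∀ n (G : Graph (suc n)) → Acyclic G → degreeSum G ≤ 2 * n
acyclic⇒degreeSum≤ zero G _ =
  ≤-reflexive (trans (+-identityʳ (degree G zero)) (degree≡∣tabulate-removeAt∣ G zero))
acyclic⇒degreeSum≤ (suc n) G acyclic with acyclic⇒leaf G acyclic zero
... | ℓ , leaf = begin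
  degreeSum G                                              ≡⟨ degreeSum-deleteVertex G ℓ ⟩
  degree G ℓ + (degree G ℓ + degreeSum (deleteVertex G ℓ)) ≤⟨ +-mono-≤ leaf (+-mono-≤ leaf degreeSum≤) ⟩
  1 + (1 + 2 * n)                                          ≡⟨ *-suc 2 n ⟨
  2 * suc n                                                ∎
  where
  open ≤-Reasoning
  degreeSum≤ : degreeSum (deleteVertex G ℓ) ≤ 2 * n
  degreeSum≤ = acyclic⇒degreeSum≤ n (deleteVertex G ℓ) (acyclic-deleteVertex G ℓ acyclic)

acyclic⇒2-colourable : ∀ n (G : Graph n) → Acyclic G → Σ (Fin n → Bool) (ProperColouring G)
acyclic⇒2-colourable zero    G _ = (λ ()) , λ ()
acyclic⇒2-colourable (suc n) G acyclic with acyclic⇒leaf G acyclic zero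
... | ℓ , leaf with acyclic⇒2-colourable n (deleteVertex G ℓ) (acyclic-deleteVertex G ℓ acyclic)
...   | c , proper with ∣tabulate∣≤1⇒avoidable (removeAt (Graph.adj G ℓ) ℓ) c
                         (subst (_≤ 1) (degree≡∣tabulate-removeAt∣ G ℓ) leaf)
...     | b , avoids = insertAt c ℓ b , insertAt-properColouring G ℓ proper avoids

connected⇒positiveDegree : ∀ n (G : Graph (suc (suc n))) → Connected G → ∀ v → 1 ≤ degree G v
connected⇒positiveDegree n G connected v =
  true⇒1≤∣tabulate∣ (Graph.adj G v) (proj₂ (walk⇒neighbour G (connected v u) v≢u))
  where
  u = punchIn v zero
  v≢u : v ≢ u
  v≢u = punchInᵢ≢i v zero ∘ sym

forest⇒lowDegCount : ∀ n (G : Graph (suc n)) → Acyclic G → (∀ v → 1 ≤ degree G v) →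
  suc n + 2 ≤ 2 * lowDegCount G
forest⇒lowDegCount n G acyclic 1≤degree = +-cancelˡ-≤ (2 * n) _ _ (begin
  2 * n + (suc n + 2)             ≡⟨ rearrange n ⟨
  suc n * 3                       ≤⟨ *≤sum 3 weight 3≤weight ⟩
  sum weight                      ≡⟨ sum-weight ⟩
  degreeSum G + 2 * lowDegCount G ≤⟨ +-monoˡ-≤ _ (acyclic⇒degreeSum≤ n G acyclic) ⟩
  2 * n + 2 * lowDegCount G       ∎)
  where
  open ≤-Reasoning
  rearrange : ∀ n → suc n * 3 ≡ 2 * n + (suc n + 2)
  rearrange = solve-∀

  weight : Fin (suc n) → ℕ
  weight i = degree G i + 2 * indicator (lowDegree G i)

  3≤weight : ∀ i → 3 ≤ weight i
  3≤weight i with degree G i ≤? 2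
  ... | yes _   = +-monoˡ-≤ 2 (1≤degree i)
  ... | no  d≰2 = ≤-trans (≰⇒> d≰2) (m≤m+n _ _)

  sum-weight : sum weight ≡ degreeSum G + 2 * lowDegCount G
  sum-weight = trans (∑-distrib-+ (degree G) (λ i → 2 * indicator (lowDegree G i)))
    (cong (degreeSum G +_) (trans (sym (*-distribˡ-sum 2 (indicator ∘ lowDegree G)))
      (cong (2 *_) (sym (∣tabulate∣≡sum (lowDegree G))))))

module _ {n : ℕ} (G : Graph n) where

  lowClass : (Fin n → Bool) → Subset n
  lowClass c = tabulate (λ i → lowDegree G i ∧ c i)

  lowClass-lowDegree : ∀ c i → i ∈ lowClass c → degree G i ≤ 2
  lowClass-lowDegree c i i∈I = toWitness {a? = degree G i ≤? 2}
    (proj₁ (T-∧ .to (∈-tabulate⁻ {f = λ k → lowDegree G k ∧ c k} i∈I)))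

  lowClass-independent : ∀ {c} → ProperColouring G c → Independent G (lowClass c)
  lowClass-independent {c} proper i j i∈I j∈I a = proper i j a (trans (colour i∈I) (sym (colour j∈I)))
    where
    colour : ∀ {k} → k ∈ lowClass c → c k ≡ true
    colour {k} k∈I =
      T-≡ .to (proj₂ (T-∧ {lowDegree G k} .to (∈-tabulate⁻ {f = λ k → lowDegree G k ∧ c k} k∈I)))

  ∣lowClass∣+∣lowClass-not∣ : ∀ c → ∣ lowClass c ∣ + ∣ lowClass (not ∘ c) ∣ ≡ lowDegCount G
  ∣lowClass∣+∣lowClass-not∣ = ∣∧∣+∣∧not∣≡∣tabulate∣ (lowDegree G)

  bipartite⇒lowIndependentSet : ∀ {c} → ProperColouring G c →
    Σ (Subset n) λ I → Independent G I × (∀ i → i ∈ I → degree G i ≤ 2) × lowDegCount G ≤ 2 * ∣ I ∣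
  bipartite⇒lowIndependentSet {c} proper with +≤2*⊎+≤2* ∣ lowClass c ∣ ∣ lowClass (not ∘ c) ∣
  ... | inj₁ ≤2∣I∣ = lowClass c , lowClass-independent proper , lowClass-lowDegree c ,
                     subst (_≤ 2 * ∣ lowClass c ∣) (∣lowClass∣+∣lowClass-not∣ c) ≤2∣I∣
  ... | inj₂ ≤2∣I∣ = lowClass (not ∘ c) , lowClass-independent (ProperColouring-not G proper) ,
                     lowClass-lowDegree (not ∘ c) ,
                     subst (_≤ 2 * ∣ lowClass (not ∘ c) ∣) (∣lowClass∣+∣lowClass-not∣ c) ≤2∣I∣

lemma1 : (n : ℕ) → 2 ≤ n → (G : Graph n) → IsTree G →
    (n + 2 ≤ 2 * lowDegCount G)
    × Σ (Subset n) λ I → Independent G I × (∀ i → i ∈ I → degree G i ≤ 2) × (n ≤ 4 * ∣ I ∣)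
lemma1 n@(suc (suc m)) (s≤s (s≤s _)) G (connected , acyclic) =
  n+2≤2L , quarter (bipartite⇒lowIndependentSet G (proj₂ (acyclic⇒2-colourable n G acyclic)))
  where
  n+2≤2L : n + 2 ≤ 2 * lowDegCount G
  n+2≤2L = forest⇒lowDegCount (suc m) G acyclic (connected⇒positiveDegree m G connected)

  quarter : Σ (Subset n) (λ I → Independent G I × (∀ i → i ∈ I → degree G i ≤ 2) × lowDegCount G ≤ 2 * ∣ I ∣) →
            Σ (Subset n) (λ I → Independent G I × (∀ i → i ∈ I → degree G i ≤ 2) × n ≤ 4 * ∣ I ∣)
  quarter (I , independent , lowDeg , L≤2∣I∣) = I , independent , lowDeg , (begin
    n                 ≤⟨ m≤m+n n 2 ⟩
    n + 2             ≤⟨ n+2≤2L ⟩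
    2 * lowDegCount G ≤⟨ *-monoʳ-≤ 2 L≤2∣I∣ ⟩
    2 * (2 * ∣ I ∣)   ≡⟨ *-assoc 2 2 ∣ I ∣ ⟨
    4 * ∣ I ∣         ∎)
    where open ≤-Reasoning
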